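{- Let $n\ge1$ and let $\mathbb{Q}[z]_{n-1}$ be the $\mathbb{Q}$-vector space of polynomials with rational coefficients of degree at most $n-1$. Define $\mathcal{L}_{n-1}:\mathbb{Q}[z]_{n-1}\to\mathbb{Q}[z]_{n-1}$ by \[ \mathcal{L}_{n-1}(P)(z)=P(z+1)-\frac{1}{2^{n+1}}P(2z)+\frac{(-1)^{n+1}}{2^{n+1}}P\Big(\frac{2}{z}\Big)z^{n-1}. \] Then $\det(\mathcal{L}_{n-1})\neq0$; that is, $\mathcal{L}_{n-1}$ is an isomorphism. -}

module Defs where

open import Data.Nat using (ℕ; zero; suc)
open import Data.Integer using (+_)
open import Data.Rational using (ℚ; 0ℚ; 1ℚ; _+_; _*_; -_; _-_; _/_)
open import Data.List using (List; []; _∷_)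
open import Data.Vec using (Vec; []; _∷_; toList; reverse)

-- Polynomials over ℚ as coefficient lists, lowest degree first:
-- a₀ ∷ a₁ ∷ … represents a₀ + a₁ z + a₂ z² + …
Poly : Set
Poly = List ℚ

_+ₚ_ : Poly → Poly → Poly
[]       +ₚ q        = q
(a ∷ p)  +ₚ []       = a ∷ p
(a ∷ p)  +ₚ (b ∷ q)  = (a + b) ∷ (p +ₚ q)

_·ₚ_ : ℚ → Poly → Poly
c ·ₚ []      = []
c ·ₚ (a ∷ p) = (c * a) ∷ (c ·ₚ p)

_*ₚ_ : Poly → Poly → Poly
[]      *ₚ q = []
(a ∷ p) *ₚ q = (a ·ₚ q) +ₚ (0ℚ ∷ (p *ₚ q))

_∘ₚ_ : Poly → Poly → Poly
[]      ∘ₚ q = []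
(a ∷ p) ∘ₚ q = (a ∷ []) +ₚ (q *ₚ (p ∘ₚ q))

_^ℚ_ : ℚ → ℕ → ℚ
x ^ℚ zero  = 1ℚ
x ^ℚ suc k = x * (x ^ℚ k)

-- The space ℚ[z]_{n-1} of polynomials of degree ≤ n-1 is represented by
-- coefficient vectors Vec ℚ n.
toPoly : ∀ {n} → Vec ℚ n → Poly
toPoly = toList

-- coefficient vector of a polynomial, keeping the coefficients of
-- z⁰ … z^{n-1} (all other coefficients are zero whenever this is applied below)
coeffs : (n : ℕ) → Poly → Vec ℚ n
coeffs zero    p       = []
coeffs (suc n) []      = 0ℚ ∷ coeffs n []
coeffs (suc n) (a ∷ p) = a ∷ coeffs n p

shift1 : ∀ {n} → Vec ℚ n → Vec ℚ n
shift1 {n} P = coeffs n (toPoly P ∘ₚ (1ℚ ∷ 1ℚ ∷ []))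

scale2 : ∀ {n} → Vec ℚ n → Vec ℚ n
scale2 {n} P = coeffs n (toPoly P ∘ₚ (0ℚ ∷ (+ 2 / 1) ∷ []))

-- P(2/z) z^{n-1}: if P(2z) = Σ_{k<n} b_k z^k then
-- P(2/z) z^{n-1} = Σ_{k<n} b_k z^{n-1-k}, i.e. the coefficient vector of
-- P(2z) read backwards.
inv2 : ∀ {n} → Vec ℚ n → Vec ℚ n
inv2 P = reverse (scale2 P)

infixl 6 _⊕_
infixr 7 _⊙_
_⊕_ : ∀ {n} → Vec ℚ n → Vec ℚ n → Vec ℚ n
[]      ⊕ []      = []
(a ∷ u) ⊕ (b ∷ v) = (a + b) ∷ (u ⊕ v)

_⊙_ : ∀ {n} → ℚ → Vec ℚ n → Vec ℚ n
c ⊙ []      = []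
c ⊙ (a ∷ u) = (c * a) ∷ (c ⊙ u)

half : ℚ
half = + 1 / 2

𝓛 : (n : ℕ) → Vec ℚ n → Vec ℚ n
𝓛 n P = shift1 P
      ⊕ ((- (half ^ℚ suc n)) ⊙ scale2 P)
      ⊕ ((((- 1ℚ) ^ℚ suc n) * (half ^ℚ suc n)) ⊙ inv2 P)

-- Write t = z - 1 and P(z) = Q(t - 1), i.e. Q = P(· + 2).  In these coordinates
-- 𝓛_{n-1} becomes  Q ↦ Q(t) - 2^{-(n+1)} Q(2t) + (-1)^{n+1} 2^{-(n+1)} (1+t)^{n-1} Q(-2t/(1+t)),
-- which sends t^k to a polynomial with lowest term
-- (1 - 2^{k-n-1} + (-1)^{n+1+k} 2^{k-n-1}) t^k.  The matrix in the monomial basis is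
-- therefore triangular, and its diagonal entries are 1 or 1 - 2^{k-n} ≠ 0.
-- Polynomial identities are checked by evaluation; P(2/z) z^{n-1} is handled through
-- the binary form Σ pₖ Xᵏ Y^{n-1-k}, so no division by z is needed.
module Submission where

open import Defs
open import Data.Nat using (ℕ; zero; suc)
import Data.Integer as ℤ
open import Data.Rational using (ℚ; 0ℚ; 1ℚ; _+_; _*_; -_; _-_; _/_; 1/_; _<_; _≤_; _<?_; NonZero; ≢-nonZero)
open import Data.Rational.Properties
open import Data.Rational.Solver using (module +-*-Solver)
open import Data.List using ([]; _∷_; drop)
open import Data.List.Relation.Unary.All using (All; []; _∷_)
open import Data.Vec using (Vec; []; _∷_; _∷ʳ_; reverse; replicate; head)
open import Data.Vec.Properties using (reverse-∷; ∷-injectiveˡ; ∷-injectiveʳ)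
open import Data.Unit using (tt)
open import Data.Product using (_,_; proj₁; proj₂)
open import Data.Sum using (_⊎_; inj₁; inj₂; swap) renaming (map to ⊎-map)
open import Function using (_∘_)
open import Function.Definitions using (Bijective; Injective; Surjective)
open import Function.Consequences.Propositional
  using (inverseᵇ⇒bijective; strictlyInverseˡ⇒inverseˡ; strictlyInverseʳ⇒inverseʳ)
open import Function.Construct.Composition using () renaming (bijective to ∘-bijective)
open import Relation.Binary.PropositionalEquality
open import Relation.Nullary.Decidable using (toWitness)
open import Algebra.Properties.Group +-0-group
  using (x∙y⁻¹≈ε⇒x≈y) renaming (∙-cancelˡ to +-cancelˡ; ∙-cancelʳ to +-cancelʳ)
open +-*-Solver
open ≡-Reasoning

variable
  n : ℕ

two : ℚ
two = ℤ.+ 2 / 1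

a+x*0≡a : ∀ a x → a + x * 0ℚ ≡ a
a+x*0≡a a x = trans (cong (a +_) (*-zeroʳ x)) (+-identityʳ a)

0*x+1≡1 : ∀ x → 0ℚ * x + 1ℚ ≡ 1ℚ
0*x+1≡1 x = trans (cong (_+ 1ℚ) (*-zeroˡ x)) (+-identityˡ 1ℚ)

1^n≡1 : ∀ n → 1ℚ ^ℚ n ≡ 1ℚ
1^n≡1 zero    = refl
1^n≡1 (suc n) = cong (1ℚ *_) (1^n≡1 n)

*-cancelʳ-≢0 : ∀ {d a b} → d ≢ 0ℚ → a * d ≡ b * d → a ≡ b
*-cancelʳ-≢0 {d} {a} {b} d≢0 ad≡bd = begin
  a              ≡⟨ sym (*-identityʳ a) ⟩
  a * 1ℚ         ≡⟨ cong (a *_) (sym (*-inverseʳ d)) ⟩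
  a * (d * 1/ d) ≡⟨ sym (*-assoc a d (1/ d)) ⟩
  a * d * 1/ d   ≡⟨ cong (_* 1/ d) ad≡bd ⟩
  b * d * 1/ d   ≡⟨ *-assoc b d (1/ d) ⟩
  b * (d * 1/ d) ≡⟨ cong (b *_) (*-inverseʳ d) ⟩
  b * 1ℚ         ≡⟨ *-identityʳ b ⟩
  b              ∎
  where
  instance
    d-nonZero : NonZero d
    d-nonZero = ≢-nonZero d≢0

half^n≤1 : ∀ n → half ^ℚ n ≤ 1ℚ
half^n≤1 zero    = ≤-refl
half^n≤1 (suc n) = ≤-trans (*-monoˡ-≤-nonNeg half (half^n≤1 n)) (toWitness {a? = half * 1ℚ ≤? 1ℚ} tt)

half^suc<1 : ∀ n → half ^ℚ suc n < 1ℚ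
half^suc<1 n = ≤-<-trans (*-monoˡ-≤-nonNeg half (half^n≤1 n)) (toWitness {a? = half * 1ℚ <? 1ℚ} tt)

IsSign : ℚ → Set
IsSign s = s ≡ 1ℚ ⊎ s ≡ - 1ℚ

IsSign-neg : ∀ {s} → IsSign s → IsSign (- s)
IsSign-neg = swap ∘ ⊎-map (cong (-_)) (cong (-_))

IsSign-pow : ∀ k → IsSign ((- 1ℚ) ^ℚ k)
IsSign-pow zero    = inj₁ refl
IsSign-pow (suc k) = swap (⊎-map (cong (- 1ℚ *_)) (cong (- 1ℚ *_)) (IsSign-pow k))

-- Polynomial evaluation

evalₚ : Poly → ℚ → ℚ
evalₚ []      x = 0ℚ
evalₚ (a ∷ p) x = a + x * evalₚ p x

evalₚ-+ₚ : ∀ p q x → evalₚ (p +ₚ q) x ≡ evalₚ p x + evalₚ q x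
evalₚ-+ₚ []      q       x = sym (+-identityˡ _)
evalₚ-+ₚ (a ∷ p) []      x = sym (+-identityʳ _)
evalₚ-+ₚ (a ∷ p) (b ∷ q) x rewrite evalₚ-+ₚ p q x =
  solve 5 (λ a b x P Q → (a :+ b) :+ x :* (P :+ Q) := (a :+ x :* P) :+ (b :+ x :* Q))
    refl a b x (evalₚ p x) (evalₚ q x)

evalₚ-·ₚ : ∀ c p x → evalₚ (c ·ₚ p) x ≡ c * evalₚ p x
evalₚ-·ₚ c []      x = sym (*-zeroʳ c)
evalₚ-·ₚ c (a ∷ p) x rewrite evalₚ-·ₚ c p x =
  solve 4 (λ c a x P → c :* a :+ x :* (c :* P) := c :* (a :+ x :* P)) refl c a x (evalₚ p x)

evalₚ-*ₚ : ∀ p q x → evalₚ (p *ₚ q) x ≡ evalₚ p x * evalₚ q x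
evalₚ-*ₚ []      q x = sym (*-zeroˡ (evalₚ q x))
evalₚ-*ₚ (a ∷ p) q x
  rewrite evalₚ-+ₚ (a ·ₚ q) (0ℚ ∷ (p *ₚ q)) x | evalₚ-·ₚ a q x | evalₚ-*ₚ p q x =
  solve 4 (λ a x P Q → a :* Q :+ (con 0ℚ :+ x :* (P :* Q)) := (a :+ x :* P) :* Q)
    refl a x (evalₚ p x) (evalₚ q x)

evalₚ-∘ₚ : ∀ p q x → evalₚ (p ∘ₚ q) x ≡ evalₚ p (evalₚ q x)
evalₚ-∘ₚ []      q x = refl
evalₚ-∘ₚ (a ∷ p) q x
  rewrite evalₚ-+ₚ (a ∷ []) (q *ₚ (p ∘ₚ q)) x | evalₚ-*ₚ q (p ∘ₚ q) x | evalₚ-∘ₚ p q x =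
  cong (_+ _) (a+x*0≡a a x)

evalₚ-linear : ∀ b a x → evalₚ (b ∷ a ∷ []) x ≡ b + a * x
evalₚ-linear b a x = cong (b +_) (trans (cong (x *_) (a+x*0≡a a x)) (*-comm x a))

evalₚ-allZero : ∀ {p} x → All (_≡ 0ℚ) p → evalₚ p x ≡ 0ℚ
evalₚ-allZero x []         = refl
evalₚ-allZero x (refl ∷ z) = trans (cong (λ e → 0ℚ + x * e) (evalₚ-allZero x z)) (a+x*0≡a 0ℚ x)

DegreeBelow : ℕ → Poly → Set
DegreeBelow n p = All (_≡ 0ℚ) (drop n p)

degreeBelow-[] : ∀ n → DegreeBelow n []
degreeBelow-[] zero    = []
degreeBelow-[] (suc n) = []

degreeBelow-suc : ∀ n p → DegreeBelow n p → DegreeBelow (suc n) p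
degreeBelow-suc zero    []      _       = []
degreeBelow-suc zero    (a ∷ p) (_ ∷ z) = z
degreeBelow-suc (suc n) []      _       = []
degreeBelow-suc (suc n) (a ∷ p) z       = degreeBelow-suc n p z

degreeBelow-+ₚ : ∀ n p q → DegreeBelow n p → DegreeBelow n q → DegreeBelow n (p +ₚ q)
degreeBelow-+ₚ zero    []      q       []          zq          = zq
degreeBelow-+ₚ zero    (a ∷ p) []      zp          []          = zp
degreeBelow-+ₚ zero    (a ∷ p) (b ∷ q) (refl ∷ zp) (refl ∷ zq) = refl ∷ degreeBelow-+ₚ zero p q zp zq
degreeBelow-+ₚ (suc n) []      q       _           zq          = zq
degreeBelow-+ₚ (suc n) (a ∷ p) []      zp          _           = zp
degreeBelow-+ₚ (suc n) (a ∷ p) (b ∷ q) zp          zq          = degreeBelow-+ₚ n p q zp zq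

degreeBelow-·ₚ : ∀ n c p → DegreeBelow n p → DegreeBelow n (c ·ₚ p)
degreeBelow-·ₚ zero    c []      []         = []
degreeBelow-·ₚ zero    c (a ∷ p) (refl ∷ z) = *-zeroʳ c ∷ degreeBelow-·ₚ zero c p z
degreeBelow-·ₚ (suc n) c []      _          = []
degreeBelow-·ₚ (suc n) c (a ∷ p) z          = degreeBelow-·ₚ n c p z

degreeBelow-const0 : ∀ n → DegreeBelow n (0ℚ ∷ [])
degreeBelow-const0 zero    = refl ∷ []
degreeBelow-const0 (suc n) = degreeBelow-[] n

degreeBelow-*ₚ-linear : ∀ n b a r → DegreeBelow n r → DegreeBelow (suc n) ((b ∷ a ∷ []) *ₚ r)
degreeBelow-*ₚ-linear n b a r z =
  degreeBelow-+ₚ (suc n) (b ·ₚ r) _ (degreeBelow-suc n (b ·ₚ r) (degreeBelow-·ₚ n b r z))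
    (degreeBelow-+ₚ n (a ·ₚ r) (0ℚ ∷ []) (degreeBelow-·ₚ n a r z) (degreeBelow-const0 n))

degreeBelow-∘ₚ-linear : ∀ (P : Vec ℚ n) b a → DegreeBelow n (toPoly P ∘ₚ (b ∷ a ∷ []))
degreeBelow-∘ₚ-linear []          b a = []
degreeBelow-∘ₚ-linear {suc n} (p ∷ P) b a =
  degreeBelow-+ₚ (suc n) (p ∷ []) ((b ∷ a ∷ []) *ₚ R) (degreeBelow-[] n)
    (degreeBelow-*ₚ-linear n b a R (degreeBelow-∘ₚ-linear P b a))
  where R = toPoly P ∘ₚ (b ∷ a ∷ [])

eval : Vec ℚ n → ℚ → ℚ
eval v = evalₚ (toPoly v)

eval-coeffs : ∀ n p x → DegreeBelow n p → eval (coeffs n p) x ≡ evalₚ p x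
eval-coeffs zero    p       x z = sym (evalₚ-allZero x z)
eval-coeffs (suc n) []      x _ =
  trans (cong (λ e → 0ℚ + x * e) (eval-coeffs n [] x (degreeBelow-[] n))) (a+x*0≡a 0ℚ x)
eval-coeffs (suc n) (a ∷ p) x z = cong (λ e → a + x * e) (eval-coeffs n p x z)

eval-coeffs-∘ₚ-linear : ∀ (P : Vec ℚ n) b a x →
                        eval (coeffs n (toPoly P ∘ₚ (b ∷ a ∷ []))) x ≡ eval P (b + a * x)
eval-coeffs-∘ₚ-linear {n} P b a x = begin
  eval (coeffs n (toPoly P ∘ₚ (b ∷ a ∷ []))) x ≡⟨ eval-coeffs n _ x (degreeBelow-∘ₚ-linear P b a) ⟩
  evalₚ (toPoly P ∘ₚ (b ∷ a ∷ [])) x          ≡⟨ evalₚ-∘ₚ (toPoly P) (b ∷ a ∷ []) x ⟩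
  eval P (evalₚ (b ∷ a ∷ []) x)                ≡⟨ cong (eval P) (evalₚ-linear b a x) ⟩
  eval P (b + a * x)                           ∎

eval-⊕ : ∀ (u v : Vec ℚ n) x → eval (u ⊕ v) x ≡ eval u x + eval v x
eval-⊕ []      []      x = sym (+-identityˡ 0ℚ)
eval-⊕ (a ∷ u) (b ∷ v) x rewrite eval-⊕ u v x =
  solve 5 (λ a b x P Q → (a :+ b) :+ x :* (P :+ Q) := (a :+ x :* P) :+ (b :+ x :* Q))
    refl a b x (eval u x) (eval v x)

eval-⊙ : ∀ c (v : Vec ℚ n) x → eval (c ⊙ v) x ≡ c * eval v x
eval-⊙ c []      x = sym (*-zeroʳ c)
eval-⊙ c (a ∷ v) x rewrite eval-⊙ c v x =
  solve 4 (λ c a x P → c :* a :+ x :* (c :* P) := c :* (a :+ x :* P)) refl c a x (eval v x)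

eval-combination : ∀ (u v w : Vec ℚ n) c e x →
                   eval (u ⊕ c ⊙ v ⊕ e ⊙ w) x ≡ eval u x + c * eval v x + e * eval w x
eval-combination u v w c e x
  rewrite eval-⊕ (u ⊕ c ⊙ v) (e ⊙ w) x | eval-⊕ u (c ⊙ v) x | eval-⊙ c v x | eval-⊙ e w x = refl

eval-replicate0 : ∀ n x → eval (replicate n 0ℚ) x ≡ 0ℚ
eval-replicate0 zero    x = refl
eval-replicate0 (suc n) x =
  trans (cong (λ e → 0ℚ + x * e) (eval-replicate0 n x)) (a+x*0≡a 0ℚ x)

eval-at-0 : ∀ (v : Vec ℚ (suc n)) → eval v 0ℚ ≡ head v
eval-at-0 (a ∷ v) = trans (cong (a +_) (*-zeroˡ (eval v 0ℚ))) (+-identityʳ a)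

-- Identity principle

quotient : ℚ → Vec ℚ (suc n) → Vec ℚ n
quotient r (a ∷ [])    = []
quotient r (a ∷ b ∷ v) = eval (b ∷ v) r ∷ quotient r (b ∷ v)

eval-quotient : ∀ r (v : Vec ℚ (suc n)) x → eval v x ≡ eval (quotient r v) x * (x - r) + eval v r
eval-quotient r (a ∷ []) x =
  solve 3 (λ a x r → a :+ x :* con 0ℚ := con 0ℚ :* (x :- r) :+ (a :+ r :* con 0ℚ)) refl a x r
eval-quotient r (a ∷ b ∷ v) x rewrite eval-quotient r (b ∷ v) x =
  solve 5 (λ a x r Q R → a :+ x :* (Q :* (x :- r) :+ R) := (R :+ x :* Q) :* (x :- r) :+ (a :+ r :* R))
    refl a x r (eval (quotient r (b ∷ v)) x) (eval (b ∷ v) r)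

quotient-injective : ∀ r {u v : Vec ℚ (suc n)} →
                     quotient r u ≡ quotient r v → eval u r ≡ eval v r → u ≡ v
quotient-injective r {a ∷ []} {b ∷ []} _ ur≡vr =
  cong (_∷ []) (+-cancelʳ (r * 0ℚ) a b ur≡vr)
quotient-injective r {a ∷ a′ ∷ u} {b ∷ b′ ∷ v} q≡q ur≡vr =
  cong₂ _∷_ (+-cancelʳ _ a b (trans ur≡vr (cong (λ e → b + r * e) (sym heads)))) tails
  where
  heads : eval (a′ ∷ u) r ≡ eval (b′ ∷ v) r
  heads = ∷-injectiveˡ q≡q
  tails : a′ ∷ u ≡ b′ ∷ v
  tails = quotient-injective r (∷-injectiveʳ q≡q) heads

-- Agreement beyond a bound, rather than everywhere, is what survives division by z - r.
eval-injective-beyond : ∀ B {u v : Vec ℚ n} → (∀ x → B < x → eval u x ≡ eval v x) → u ≡ v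
eval-injective-beyond {zero}  B {[]} {[]} _ = refl
eval-injective-beyond {suc n} B {u} {v} u≈v =
  quotient-injective r (eval-injective-beyond r q≈q) (u≈v r B<r)
  where
  r : ℚ
  r = B + 1ℚ
  B<r : B < r
  B<r = subst (_< r) (+-identityʳ B) (+-monoʳ-< B (toWitness {a? = 0ℚ <? 1ℚ} tt))
  q≈q : ∀ x → r < x → eval (quotient r u) x ≡ eval (quotient r v) x
  q≈q x r<x = *-cancelʳ-≢0 x-r≢0 (+-cancelʳ (eval u r) _ _ (begin
    eval (quotient r u) x * (x - r) + eval u r
      ≡⟨ eval-quotient r u x ⟨
    eval u x
      ≡⟨ u≈v x (<-trans B<r r<x) ⟩
    eval v x
      ≡⟨ eval-quotient r v x ⟩
    eval (quotient r v) x * (x - r) + eval v r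
      ≡⟨ cong (eval (quotient r v) x * (x - r) +_) (u≈v r B<r) ⟨
    eval (quotient r v) x * (x - r) + eval u r
      ∎))
    where
    x-r≢0 : x - r ≢ 0ℚ
    x-r≢0 x-r≡0 = <⇒≢ r<x (sym (x∙y⁻¹≈ε⇒x≈y x r x-r≡0))

eval-injective : {u v : Vec ℚ n} → (∀ x → eval u x ≡ eval v x) → u ≡ v
eval-injective u≈v = eval-injective-beyond 0ℚ (λ x _ → u≈v x)

-- Binary forms and linear substitutions

-- heval v X Y = Σₖ vₖ Xᵏ Y^{n-1-k}, the homogenisation of v in degree n - 1.
heval : Vec ℚ n → ℚ → ℚ → ℚ
heval []              X Y = 0ℚ
heval {suc m} (a ∷ v) X Y = a * Y ^ℚ m + X * heval v X Y

eval≡heval : ∀ (v : Vec ℚ n) x → eval v x ≡ heval v x 1ℚ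
eval≡heval []              x = refl
eval≡heval {suc m} (a ∷ v) x rewrite eval≡heval v x | 1^n≡1 m | *-identityʳ a = refl

heval-⊕ : ∀ (u v : Vec ℚ n) X Y → heval (u ⊕ v) X Y ≡ heval u X Y + heval v X Y
heval-⊕ []      []      X Y = sym (+-identityˡ 0ℚ)
heval-⊕ {suc m} (a ∷ u) (b ∷ v) X Y rewrite heval-⊕ u v X Y =
  solve 6 (λ a b W X P Q → (a :+ b) :* W :+ X :* (P :+ Q) := (a :* W :+ X :* P) :+ (b :* W :+ X :* Q))
    refl a b (Y ^ℚ m) X (heval u X Y) (heval v X Y)

heval-⊙ : ∀ c (v : Vec ℚ n) X Y → heval (c ⊙ v) X Y ≡ c * heval v X Y
heval-⊙ c []      X Y = sym (*-zeroʳ c)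
heval-⊙ {suc m} c (a ∷ v) X Y rewrite heval-⊙ c v X Y =
  solve 5 (λ c a W X P → c :* a :* W :+ X :* (c :* P) := c :* (a :* W :+ X :* P))
    refl c a (Y ^ℚ m) X (heval v X Y)

heval-replicate0 : ∀ n X Y → heval (replicate n 0ℚ) X Y ≡ 0ℚ
heval-replicate0 zero    X Y = refl
heval-replicate0 (suc n) X Y rewrite heval-replicate0 n X Y =
  solve 2 (λ W X → con 0ℚ :* W :+ X :* con 0ℚ := con 0ℚ) refl (Y ^ℚ n) X

heval-0∷ : ∀ (v : Vec ℚ n) X Y → heval (0ℚ ∷ v) X Y ≡ X * heval v X Y
heval-0∷ {n} v X Y = trans (cong (_+ X * heval v X Y) (*-zeroˡ (Y ^ℚ n))) (+-identityˡ _)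

heval-∷ʳ : ∀ (v : Vec ℚ n) a X Y → heval (v ∷ʳ a) X Y ≡ Y * heval v X Y + a * X ^ℚ n
heval-∷ʳ [] a X Y =
  solve 3 (λ a X Y → a :* con 1ℚ :+ X :* con 0ℚ := Y :* con 0ℚ :+ a :* con 1ℚ) refl a X Y
heval-∷ʳ {suc m} (b ∷ v) a X Y rewrite heval-∷ʳ v a X Y =
  solve 7 (λ b Y W X H a V → b :* (Y :* W) :+ X :* (Y :* H :+ a :* V)
                           := Y :* (b :* W :+ X :* H) :+ a :* (X :* V))
    refl b Y (Y ^ℚ m) X (heval v X Y) a (X ^ℚ m)

heval-reverse : ∀ (v : Vec ℚ n) X Y → heval (reverse v) X Y ≡ heval v Y X
heval-reverse []              X Y = refl
heval-reverse {suc m} (a ∷ v) X Y rewrite reverse-∷ a v | heval-∷ʳ (reverse v) a X Y | heval-reverse v X Y =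
  +-comm (Y * heval v Y X) (a * X ^ℚ m)

eval-reverse : ∀ (v : Vec ℚ n) x → eval (reverse v) x ≡ heval v 1ℚ x
eval-reverse v x = trans (eval≡heval (reverse v) x) (heval-reverse v x 1ℚ)

mulLinear : ℚ → ℚ → Vec ℚ n → Vec ℚ (suc n)
mulLinear α β v = (0ℚ ∷ α ⊙ v) ⊕ ((β ⊙ v) ∷ʳ 0ℚ)

heval-mulLinear : ∀ α β (v : Vec ℚ n) X Y →
                  heval (mulLinear α β v) X Y ≡ (α * X + β * Y) * heval v X Y
heval-mulLinear {n} α β v X Y
  rewrite heval-⊕ (0ℚ ∷ α ⊙ v) ((β ⊙ v) ∷ʳ 0ℚ) X Y | heval-0∷ (α ⊙ v) X Y
        | heval-∷ʳ (β ⊙ v) 0ℚ X Y | heval-⊙ α v X Y | heval-⊙ β v X Y =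
  solve 6 (λ α β X Y H V → X :* (α :* H) :+ (Y :* (β :* H) :+ con 0ℚ :* V)
                         := (α :* X :+ β :* Y) :* H)
    refl α β X Y (heval v X Y) (X ^ℚ n)

linearPower : ℚ → ℚ → (n : ℕ) → Vec ℚ (suc n)
linearPower γ δ zero    = 1ℚ ∷ []
linearPower γ δ (suc n) = mulLinear γ δ (linearPower γ δ n)

heval-linearPower : ∀ γ δ n X Y → heval (linearPower γ δ n) X Y ≡ (γ * X + δ * Y) ^ℚ n
heval-linearPower γ δ zero    X Y = a+x*0≡a 1ℚ X
heval-linearPower γ δ (suc n) X Y =
  trans (heval-mulLinear γ δ (linearPower γ δ n) X Y)
        (cong ((γ * X + δ * Y) *_) (heval-linearPower γ δ n X Y))

substitute : ℚ → ℚ → ℚ → ℚ → Vec ℚ n → Vec ℚ n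
substitute α β γ δ []              = []
substitute {suc m} α β γ δ (a ∷ v) = a ⊙ linearPower γ δ m ⊕ mulLinear α β (substitute α β γ δ v)

heval-substitute : ∀ α β γ δ (v : Vec ℚ n) X Y →
                   heval (substitute α β γ δ v) X Y ≡ heval v (α * X + β * Y) (γ * X + δ * Y)
heval-substitute α β γ δ []              X Y = refl
heval-substitute {suc m} α β γ δ (a ∷ v) X Y
  rewrite heval-⊕ (a ⊙ linearPower γ δ m) (mulLinear α β (substitute α β γ δ v)) X Y
        | heval-⊙ a (linearPower γ δ m) X Y | heval-linearPower γ δ m X Y
        | heval-mulLinear α β (substitute α β γ δ v) X Y | heval-substitute α β γ δ v X Y = refl

eval-substitute : ∀ α β γ δ (v : Vec ℚ n) x →
                  eval (substitute α β γ δ v) x ≡ heval v (α * x + β) (γ * x + δ)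
eval-substitute α β γ δ v x = begin
  eval (substitute α β γ δ v) x                  ≡⟨ eval≡heval (substitute α β γ δ v) x ⟩
  heval (substitute α β γ δ v) x 1ℚ              ≡⟨ heval-substitute α β γ δ v x 1ℚ ⟩
  heval v (α * x + β * 1ℚ) (γ * x + δ * 1ℚ)      ≡⟨ cong₂ (heval v) (cong (α * x +_) (*-identityʳ β))
                                                                   (cong (γ * x +_) (*-identityʳ δ)) ⟩
  heval v (α * x + β) (γ * x + δ)                ∎

translate : ℚ → Vec ℚ n → Vec ℚ n
translate a = substitute 1ℚ a 0ℚ 1ℚ

dilate : ℚ → Vec ℚ n → Vec ℚ n
dilate l = substitute l 0ℚ 0ℚ 1ℚ

eval-translate : ∀ a (v : Vec ℚ n) x → eval (translate a v) x ≡ eval v (x + a)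
eval-translate a v x = begin
  eval (translate a v) x             ≡⟨ eval-substitute 1ℚ a 0ℚ 1ℚ v x ⟩
  heval v (1ℚ * x + a) (0ℚ * x + 1ℚ) ≡⟨ cong₂ (heval v) (cong (_+ a) (*-identityˡ x)) (0*x+1≡1 x) ⟩
  heval v (x + a) 1ℚ                 ≡⟨ eval≡heval v (x + a) ⟨
  eval v (x + a)                     ∎

heval-translate : ∀ a (v : Vec ℚ n) X Y → heval (translate a v) X Y ≡ heval v (X + a * Y) Y
heval-translate a v X Y = trans (heval-substitute 1ℚ a 0ℚ 1ℚ v X Y)
  (cong₂ (heval v) (cong (_+ a * Y) (*-identityˡ X)) (trans (cong (_+ 1ℚ * Y) (*-zeroˡ X))
    (trans (+-identityˡ (1ℚ * Y)) (*-identityˡ Y))))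

eval-dilate : ∀ l (v : Vec ℚ n) x → eval (dilate l v) x ≡ eval v (l * x)
eval-dilate l v x = begin
  eval (dilate l v) x                 ≡⟨ eval-substitute l 0ℚ 0ℚ 1ℚ v x ⟩
  heval v (l * x + 0ℚ) (0ℚ * x + 1ℚ)  ≡⟨ cong₂ (heval v) (+-identityʳ (l * x)) (0*x+1≡1 x) ⟩
  heval v (l * x) 1ℚ                  ≡⟨ eval≡heval v (l * x) ⟨
  eval v (l * x)                      ∎

translate-translate : ∀ a b → a + b ≡ 0ℚ → (v : Vec ℚ n) → translate a (translate b v) ≡ v
translate-translate a b a+b≡0 v = eval-injective λ x → begin
  eval (translate a (translate b v)) x ≡⟨ eval-translate a (translate b v) x ⟩
  eval (translate b v) (x + a)         ≡⟨ eval-translate b v (x + a) ⟩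
  eval v (x + a + b)                   ≡⟨ cong (eval v) (+-assoc x a b) ⟩
  eval v (x + (a + b))                 ≡⟨ cong (λ c → eval v (x + c)) a+b≡0 ⟩
  eval v (x + 0ℚ)                      ≡⟨ cong (eval v) (+-identityʳ x) ⟩
  eval v x                             ∎

translate-bijective : ∀ a → Bijective {A = Vec ℚ n} _≡_ _≡_ (translate a)
translate-bijective a = inverseᵇ⇒bijective {f⁻¹ = translate (- a)}
  ( strictlyInverseˡ⇒inverseˡ {f⁻¹ = translate (- a)} (translate a)
      (translate-translate a (- a) (+-inverseʳ a))
  , strictlyInverseʳ⇒inverseʳ {f⁻¹ = translate (- a)} (translate a)
      (translate-translate (- a) a (+-inverseˡ a)))

bijective-≗ : ∀ {a b} {A : Set a} {B : Set b} {f g : A → B} →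
              f ≗ g → Bijective _≡_ _≡_ f → Bijective _≡_ _≡_ g
bijective-≗ {f = f} {g} f≗g (f-injective , f-surjective) = g-injective , g-surjective
  where
  g-injective : Injective _≡_ _≡_ g
  g-injective gx≡gy = f-injective (trans (f≗g _) (trans gx≡gy (sym (f≗g _))))
  g-surjective : Surjective _≡_ _≡_ g
  g-surjective y = proj₁ (f-surjective y) , λ { refl → trans (sym (f≗g _)) (proj₂ (f-surjective y) refl) }

⊕-cancelˡ : ∀ (u : Vec ℚ n) {v w} → u ⊕ v ≡ u ⊕ w → v ≡ w
⊕-cancelˡ []      {[]}    {[]}    _ = refl
⊕-cancelˡ (a ∷ u) {b ∷ v} {c ∷ w} e =
  cong₂ _∷_ (+-cancelˡ a b c (∷-injectiveˡ e)) (⊕-cancelˡ u (∷-injectiveʳ e))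

a⊙w⊕[y⊕-a⊙w]≡y : ∀ a (w y : Vec ℚ n) → a ⊙ w ⊕ (y ⊕ (- a) ⊙ w) ≡ y
a⊙w⊕[y⊕-a⊙w]≡y a []      []      = refl
a⊙w⊕[y⊕-a⊙w]≡y a (b ∷ w) (c ∷ y) =
  cong₂ _∷_ (solve 3 (λ a b c → a :* b :+ (c :+ (:- a) :* b) := c) refl a b c) (a⊙w⊕[y⊕-a⊙w]≡y a w y)

-- First column u, lower right block G.
triangular-bijective : ∀ {F : Vec ℚ (suc n) → Vec ℚ (suc n)} {G : Vec ℚ n → Vec ℚ n}
                       (u : Vec ℚ (suc n)) → head u ≢ 0ℚ →
                       (∀ a v → F (a ∷ v) ≡ a ⊙ u ⊕ (0ℚ ∷ G v)) →
                       Bijective _≡_ _≡_ G → Bijective _≡_ _≡_ F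
triangular-bijective {n} {F} {G} (d ∷ w) d≢0 F-cons (G-injective , G-surjective) =
  F-injective , F-surjective
  where
  F-cons′ : ∀ a v → F (a ∷ v) ≡ a * d ∷ a ⊙ w ⊕ G v
  F-cons′ a v = trans (F-cons a v) (cong (_∷ a ⊙ w ⊕ G v) (+-identityʳ (a * d)))

  F-injective : Injective _≡_ _≡_ F
  F-injective {a ∷ u} {b ∷ v} Fau≡Fbv = cong₂ _∷_ a≡b (G-injective (⊕-cancelˡ (a ⊙ w) tails))
    where
    Fau≡Fbv′ : a * d ∷ a ⊙ w ⊕ G u ≡ b * d ∷ b ⊙ w ⊕ G v
    Fau≡Fbv′ = trans (sym (F-cons′ a u)) (trans Fau≡Fbv (F-cons′ b v))
    a≡b : a ≡ b
    a≡b = *-cancelʳ-≢0 d≢0 (∷-injectiveˡ Fau≡Fbv′)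
    tails : a ⊙ w ⊕ G u ≡ a ⊙ w ⊕ G v
    tails = trans (∷-injectiveʳ Fau≡Fbv′) (cong (λ c → c ⊙ w ⊕ G v) (sym a≡b))

  F-surjective : Surjective _≡_ _≡_ F
  F-surjective (y ∷ ys) = a ∷ v , λ { refl → trans (F-cons′ a v) (cong₂ _∷_ a*d≡y tails) }
    where
    instance
      d-nonZero : NonZero d
      d-nonZero = ≢-nonZero d≢0
    a : ℚ
    a = y * 1/ d
    a*d≡y : a * d ≡ y
    a*d≡y = trans (*-assoc y (1/ d) d) (trans (cong (y *_) (*-inverseˡ d)) (*-identityʳ y))
    v : Vec ℚ n
    v = proj₁ (G-surjective (ys ⊕ (- a) ⊙ w))
    tails : a ⊙ w ⊕ G v ≡ ys
    tails = trans (cong (a ⊙ w ⊕_) (proj₂ (G-surjective (ys ⊕ (- a) ⊙ w)) refl))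
                  (a⊙w⊕[y⊕-a⊙w]≡y a w ys)

-- The operator 𝓛 and its conjugate

κ : ℕ → ℚ
κ n = half ^ℚ suc n

σ : ℕ → ℚ
σ n = (- 1ℚ) ^ℚ suc n

eval-shift1 : ∀ (P : Vec ℚ n) x → eval (shift1 P) x ≡ eval P (x + 1ℚ)
eval-shift1 P x = trans (eval-coeffs-∘ₚ-linear P 1ℚ 1ℚ x)
  (cong (eval P) (trans (+-comm 1ℚ (1ℚ * x)) (cong (_+ 1ℚ) (*-identityˡ x))))

eval-scale2 : ∀ (P : Vec ℚ n) x → eval (scale2 P) x ≡ eval P (two * x)
eval-scale2 P x = trans (eval-coeffs-∘ₚ-linear P 0ℚ two x) (cong (eval P) (+-identityˡ (two * x)))

scale2≡dilate : ∀ (P : Vec ℚ n) → scale2 P ≡ dilate two P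
scale2≡dilate P = eval-injective λ x → trans (eval-scale2 P x) (sym (eval-dilate two P x))

eval-inv2 : ∀ (P : Vec ℚ n) x → eval (inv2 P) x ≡ heval P two x
eval-inv2 P x = begin
  eval (reverse (scale2 P)) x
    ≡⟨ eval-reverse (scale2 P) x ⟩
  heval (scale2 P) 1ℚ x
    ≡⟨ cong (λ v → heval v 1ℚ x) (scale2≡dilate P) ⟩
  heval (dilate two P) 1ℚ x
    ≡⟨ heval-substitute two 0ℚ 0ℚ 1ℚ P 1ℚ x ⟩
  heval P (two * 1ℚ + 0ℚ * x) (0ℚ * 1ℚ + 1ℚ * x)
    ≡⟨ cong₂ (heval P) (solve 1 (λ x → con two :* con 1ℚ :+ con 0ℚ :* x := con two) refl x)
                       (solve 1 (λ x → con 0ℚ :* con 1ℚ :+ con 1ℚ :* x := x) refl x) ⟩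
  heval P two x
    ∎

eval-𝓛 : ∀ n (P : Vec ℚ n) x →
         eval (𝓛 n P) x ≡ eval P (x + 1ℚ) + (- κ n) * eval P (two * x) + σ n * κ n * heval P two x
eval-𝓛 n P x = begin
  eval (𝓛 n P) x
    ≡⟨ eval-combination (shift1 P) (scale2 P) (inv2 P) (- κ n) (σ n * κ n) x ⟩
  eval (shift1 P) x + (- κ n) * eval (scale2 P) x + σ n * κ n * eval (inv2 P) x
    ≡⟨ cong₂ (λ p q → p + (- κ n) * q + σ n * κ n * eval (inv2 P) x) (eval-shift1 P x) (eval-scale2 P x) ⟩
  eval P (x + 1ℚ) + (- κ n) * eval P (two * x) + σ n * κ n * eval (inv2 P) x
    ≡⟨ cong (λ r → eval P (x + 1ℚ) + (- κ n) * eval P (two * x) + σ n * κ n * r) (eval-inv2 P x) ⟩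
  eval P (x + 1ℚ) + (- κ n) * eval P (two * x) + σ n * κ n * heval P two x
    ∎

-- 𝓛 in the coordinates t = z - 1, Q = P(· + 2), with the sign (-1)^{n+1} generalised to s.
𝓜 : (n : ℕ) → ℚ → Vec ℚ n → Vec ℚ n
𝓜 n s v = v ⊕ (- κ n) ⊙ dilate two v ⊕ (s * κ n) ⊙ substitute (- two) 0ℚ 1ℚ 1ℚ v

eval-𝓜 : ∀ n s (v : Vec ℚ n) t →
         eval (𝓜 n s v) t ≡ eval v t + (- κ n) * eval v (two * t) + s * κ n * heval v (- two * t) (t + 1ℚ)
eval-𝓜 n s v t = begin
  eval (𝓜 n s v) t
    ≡⟨ eval-combination v (dilate two v) (substitute (- two) 0ℚ 1ℚ 1ℚ v) (- κ n) (s * κ n) t ⟩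
  eval v t + (- κ n) * eval (dilate two v) t + s * κ n * eval (substitute (- two) 0ℚ 1ℚ 1ℚ v) t
    ≡⟨ cong₂ (λ p q → eval v t + (- κ n) * p + s * κ n * q) (eval-dilate two v t)
             (eval-substitute (- two) 0ℚ 1ℚ 1ℚ v t) ⟩
  eval v t + (- κ n) * eval v (two * t) + s * κ n * heval v (- two * t + 0ℚ) (1ℚ * t + 1ℚ)
    ≡⟨ cong₂ (λ X Y → eval v t + (- κ n) * eval v (two * t) + s * κ n * heval v X Y)
             (+-identityʳ (- two * t)) (cong (_+ 1ℚ) (*-identityˡ t)) ⟩
  eval v t + (- κ n) * eval v (two * t) + s * κ n * heval v (- two * t) (t + 1ℚ)
    ∎

𝓛-conjugate : ∀ n (P : Vec ℚ n) → 𝓛 n P ≡ translate (- 1ℚ) (𝓜 n (σ n) (translate two P))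
𝓛-conjugate n P = eval-injective λ x →
  let t = x - 1ℚ
      Q = translate two P
  in begin
  eval (𝓛 n P) x
    ≡⟨ eval-𝓛 n P x ⟩
  eval P (x + 1ℚ) + (- κ n) * eval P (two * x) + σ n * κ n * heval P two x
    ≡⟨ cong₂ _+_ (cong₂ (λ p q → eval P p + (- κ n) * eval P q)
                   (solve 1 (λ x → x :+ con 1ℚ := (x :- con 1ℚ) :+ con two) refl x)
                   (solve 1 (λ x → con two :* x := con two :* (x :- con 1ℚ) :+ con two) refl x))
                 (cong₂ (λ X Y → σ n * κ n * heval P X Y)
                   (solve 1 (λ x → con two := (:- con two) :* (x :- con 1ℚ)
                                               :+ con two :* ((x :- con 1ℚ) :+ con 1ℚ)) refl x)
                   (solve 1 (λ x → x := (x :- con 1ℚ) :+ con 1ℚ) refl x)) ⟩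
  eval P (t + two) + (- κ n) * eval P (two * t + two)
    + σ n * κ n * heval P (- two * t + two * (t + 1ℚ)) (t + 1ℚ)
    ≡⟨ cong₂ _+_ (cong₂ (λ p q → p + (- κ n) * q) (eval-translate two P t) (eval-translate two P (two * t)))
                 (cong (σ n * κ n *_) (heval-translate two P (- two * t) (t + 1ℚ))) ⟨
  eval Q t + (- κ n) * eval Q (two * t) + σ n * κ n * heval Q (- two * t) (t + 1ℚ)
    ≡⟨ eval-𝓜 n (σ n) Q t ⟨
  eval (𝓜 n (σ n) Q) t
    ≡⟨ eval-translate (- 1ℚ) (𝓜 n (σ n) Q) x ⟨
  eval (translate (- 1ℚ) (𝓜 n (σ n) Q)) x
    ∎

1ᵥ : Vec ℚ (suc n)
1ᵥ {n} = 1ℚ ∷ replicate n 0ℚ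

eval-1ᵥ : ∀ n x → eval (1ᵥ {n}) x ≡ 1ℚ
eval-1ᵥ n x = trans (cong (λ e → 1ℚ + x * e) (eval-replicate0 n x)) (a+x*0≡a 1ℚ x)

heval-1ᵥ : ∀ n X Y → heval (1ᵥ {n}) X Y ≡ Y ^ℚ n
heval-1ᵥ n X Y = begin
  1ℚ * Y ^ℚ n + X * heval (replicate n 0ℚ) X Y
    ≡⟨ cong (λ e → 1ℚ * Y ^ℚ n + X * e) (heval-replicate0 n X Y) ⟩
  1ℚ * Y ^ℚ n + X * 0ℚ
    ≡⟨ a+x*0≡a (1ℚ * Y ^ℚ n) X ⟩
  1ℚ * Y ^ℚ n
    ≡⟨ *-identityˡ (Y ^ℚ n) ⟩
  Y ^ℚ n
    ∎

eval-𝓜-1ᵥ : ∀ m s t →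
            eval (𝓜 (suc m) s 1ᵥ) t ≡ 1ℚ + (- κ (suc m)) * 1ℚ + s * κ (suc m) * (t + 1ℚ) ^ℚ m
eval-𝓜-1ᵥ m s t
  rewrite eval-𝓜 (suc m) s 1ᵥ t | eval-1ᵥ m t | eval-1ᵥ m (two * t)
        | heval-1ᵥ m (- two * t) (t + 1ℚ) = refl

-- On t·v the scaled terms gain factors 2t and -2t; as 2 κ (suc m) = κ m, this is t·𝓜 m (- s) v.
𝓜-cons : ∀ m s a (v : Vec ℚ m) → 𝓜 (suc m) s (a ∷ v) ≡ a ⊙ 𝓜 (suc m) s 1ᵥ ⊕ (0ℚ ∷ 𝓜 m (- s) v)
𝓜-cons m s a v = eval-injective λ t → begin
  eval (𝓜 (suc m) s (a ∷ v)) t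
    ≡⟨ eval-𝓜 (suc m) s (a ∷ v) t ⟩
  eval (a ∷ v) t + (- κ (suc m)) * eval (a ∷ v) (two * t)
    + s * κ (suc m) * heval (a ∷ v) (- two * t) (t + 1ℚ)
    ≡⟨ solve 8 (λ a t V V₂ H P s h →
              (a :+ t :* V) :+ (:- (con half :* h)) :* (a :+ (con two :* t) :* V₂)
                :+ (s :* (con half :* h)) :* (a :* P :+ ((:- con two) :* t) :* H)
           := a :* (con 1ℚ :+ (:- (con half :* h)) :* con 1ℚ :+ (s :* (con half :* h)) :* P)
                :+ (con 0ℚ :+ t :* (V :+ (:- h) :* V₂ :+ ((:- s) :* h) :* H)))
         refl a t (eval v t) (eval v (two * t)) (heval v (- two * t) (t + 1ℚ))
              ((t + 1ℚ) ^ℚ m) s (κ m) ⟩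
  a * (1ℚ + (- κ (suc m)) * 1ℚ + s * κ (suc m) * (t + 1ℚ) ^ℚ m)
    + (0ℚ + t * (eval v t + (- κ m) * eval v (two * t)
                 + (- s) * κ m * heval v (- two * t) (t + 1ℚ)))
    ≡⟨ cong₂ (λ p q → a * p + (0ℚ + t * q)) (eval-𝓜-1ᵥ m s t) (eval-𝓜 m (- s) v t) ⟨
  a * eval (𝓜 (suc m) s 1ᵥ) t + eval (0ℚ ∷ 𝓜 m (- s) v) t
    ≡⟨ cong (_+ eval (0ℚ ∷ 𝓜 m (- s) v) t) (eval-⊙ a (𝓜 (suc m) s 1ᵥ) t) ⟨
  eval (a ⊙ 𝓜 (suc m) s 1ᵥ) t + eval (0ℚ ∷ 𝓜 m (- s) v) t
    ≡⟨ eval-⊕ (a ⊙ 𝓜 (suc m) s 1ᵥ) (0ℚ ∷ 𝓜 m (- s) v) t ⟨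
  eval (a ⊙ 𝓜 (suc m) s 1ᵥ ⊕ (0ℚ ∷ 𝓜 m (- s) v)) t
    ∎

𝓜-diagonal : ∀ m s → head (𝓜 (suc m) s 1ᵥ) ≡ 1ℚ - κ (suc m) + s * κ (suc m)
𝓜-diagonal m s = begin
  head (𝓜 (suc m) s 1ᵥ)
    ≡⟨ eval-at-0 (𝓜 (suc m) s 1ᵥ) ⟨
  eval (𝓜 (suc m) s 1ᵥ) 0ℚ
    ≡⟨ eval-𝓜-1ᵥ m s 0ℚ ⟩
  1ℚ + (- κ (suc m)) * 1ℚ + s * κ (suc m) * (0ℚ + 1ℚ) ^ℚ m
    ≡⟨ cong (λ y → 1ℚ + (- κ (suc m)) * 1ℚ + s * κ (suc m) * y)
            (trans (cong (_^ℚ m) (+-identityˡ 1ℚ)) (1^n≡1 m)) ⟩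
  1ℚ + (- κ (suc m)) * 1ℚ + s * κ (suc m) * 1ℚ
    ≡⟨ solve 2 (λ s k → con 1ℚ :+ (:- k) :* con 1ℚ :+ s :* k :* con 1ℚ := con 1ℚ :- k :+ s :* k)
               refl s (κ (suc m)) ⟩
  1ℚ - κ (suc m) + s * κ (suc m)
    ∎

diagonal≢0 : ∀ m {s} → IsSign s → 1ℚ - κ (suc m) + s * κ (suc m) ≢ 0ℚ
diagonal≢0 m (inj₁ refl) d≡0 = 1≢0 (trans entry≡1 d≡0)
  where
  entry≡1 : 1ℚ ≡ 1ℚ - κ (suc m) + 1ℚ * κ (suc m)
  entry≡1 = solve 1 (λ h → con 1ℚ := con 1ℚ :- con half :* h :+ con 1ℚ :* (con half :* h)) refl (κ m)
diagonal≢0 m (inj₂ refl) d≡0 = <⇒≢ (half^suc<1 m) (sym (x∙y⁻¹≈ε⇒x≈y 1ℚ (κ m) (trans entry≡1-κ d≡0)))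
  where
  entry≡1-κ : 1ℚ - κ m ≡ 1ℚ - κ (suc m) + (- 1ℚ) * κ (suc m)
  entry≡1-κ =
    solve 1 (λ h → con 1ℚ :- h := con 1ℚ :- con half :* h :+ con (- 1ℚ) :* (con half :* h)) refl (κ m)

𝓜-bijective : ∀ m {s} → IsSign s → Bijective _≡_ _≡_ (𝓜 m s)
𝓜-bijective zero    _ = (λ { {[]} {[]} _ → refl }) , (λ { [] → [] , λ { {[]} _ → refl } })
𝓜-bijective (suc m) {s} sign =
  triangular-bijective (𝓜 (suc m) s 1ᵥ) (diagonal≢0 m sign ∘ trans (sym (𝓜-diagonal m s)))
    (𝓜-cons m s) (𝓜-bijective m (IsSign-neg sign))

lemma6p1 : (m : ℕ) → Bijective {A = Vec ℚ (suc m)} _≡_ _≡_ (𝓛 (suc m))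
lemma6p1 m = bijective-≗ (sym ∘ 𝓛-conjugate (suc m))
  (∘-bijective _≡_ _≡_ _≡_
    (∘-bijective _≡_ _≡_ _≡_ (translate-bijective two)
                             (𝓜-bijective (suc m) (IsSign-pow (suc (suc m)))))
    (translate-bijective (- 1ℚ)))
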